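{- If the subtyping judgment $\gamma\vdash\top\preceq A$ is derivable, then $A\sim\top$ (where $\sim$ denotes either $\cong$ or $\simeq$).
   Context: Pseudo type expressions: $A::=X\mid A\to B\mid\bullet A\mid\mu X.A$ ($\alpha$-equivalent ones identified; $A[B/X]$ capture-avoiding substitution). $\top:=\mu X.\bullet X$. Tail: $t(X)=X$, $t(A\to B)=t(B)$, $t(\bullet A)=\bullet t(A)$, $t(\mu X.A)=\mu X.t(A)$. $A$ is a $\top$-variant iff $t(A)=\bullet^{m_0}\mu X_1.\bullet^{m_1}\cdots\mu X_n.\bullet^{m_n}X_i$ with $1\le i\le n$, $X_i\notin\{X_{i+1},\dots,X_n\}$, $m_i+\dots+m_n\ge1$. Properness in $X$: variable $Y$ iff $Y\ne X$; $\bullet A$ always; $A\to B$ iff both are or $B$ is a $\top$-variant; $\mu Y.A$ ($Y\ne X$) iff $A$ is or $\mu Y.A$ is a $\top$-variant. Type expressions: every subexpression $\mu X.A$ has $A$ proper in $X$. $\cong$: smallest relation closed under reflexivity, symmetry, transitivity; $A\cong B\Rightarrow\bullet A\cong\bullet B$; $A\cong C,B\cong D\Rightarrow A\to B\cong C\to D$; $A\to\top\cong\top$; $\mu X.A\cong A[\mu X.A/X]$; if $A\cong C[A/X]$ with $C$ proper in $X$ then $A\cong\mu X.C$. $\simeq$: the same rules plus $\bullet(A\to B)\simeq\bullet A\to\bullet B$. Subtyping. A subtyping assumption $\gamma$ is a finite set of pairs $X\preceq Y$ of type variables in which every variable occurs at most once (all unions in rules must again be such). Rules: $\gamma\cup\{X\preceq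 Y\}\vdash X\preceq Y$; $\gamma\vdash A\preceq\top$; $A\simeq B\Rightarrow\gamma\vdash A\preceq B$; from $\gamma_1\vdash A\preceq B$, $\gamma_2\vdash B\preceq C$ infer $\gamma_1\cup\gamma_2\vdash A\preceq C$; from $\gamma\vdash A\preceq B$ infer $\gamma\vdash\bullet A\preceq\bullet B$; from $\gamma_1\vdash A'\preceq A$, $\gamma_2\vdash B\preceq B'$ infer $\gamma_1\cup\gamma_2\vdash A\to B\preceq A'\to B'$; from $\gamma\cup\{X\preceq Y\}\vdash A\preceq B$ infer $\gamma\vdash\mu X.A\preceq\mu Y.B$ if $X$ is free neither in $\gamma$ nor $B$, $Y$ free neither in $\gamma$ nor $A$, $A$ proper in $X$, $B$ proper in $Y$; $\gamma\vdash A\preceq\bullet A$. -}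

module Defs where

open import Data.Nat using (ℕ; zero; suc; _<_; _≤_)
open import Data.Nat.Properties using (_≟_)
open import Data.List using (List; []; _∷_; map; concatMap; [_])
open import Data.List.Membership.Propositional using (_∈_)
open import Data.List.Relation.Unary.Unique.Propositional using (Unique)
open import Data.Product using (_×_; _,_; proj₁; proj₂)
open import Data.Sum using (_⊎_)
open import Data.Unit using (⊤)
open import Data.Empty using (⊥)
open import Relation.Nullary using (¬_; yes; no)
open import Relation.Binary.PropositionalEquality using (_≡_; _≢_)
open import Function.Bundles using (_⇔_)

-- Pseudo type expressions, locally nameless representation:
-- free (named) variables ` X, bound variables # k (de Bruijn indices).
-- Locally closed terms are exactly the pseudo type expressions modulo α.

infixr 7 _⇒_
data Ty : Set where
  `_  : ℕ → Ty
  #_  : ℕ → Ty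
  _⇒_ : Ty → Ty → Ty
  ●_  : Ty → Ty
  μ_  : Ty → Ty

Top : Ty
Top = μ (● (# 0))

openAt : ℕ → Ty → Ty → Ty
openAt k u (` x) = ` x
openAt k u (# i) with i ≟ k
... | yes _ = u
... | no  _ = # i
openAt k u (a ⇒ b) = openAt k u a ⇒ openAt k u b
openAt k u (● a) = ● openAt k u a
openAt k u (μ a) = μ openAt (suc k) u a

closeAt : ℕ → ℕ → Ty → Ty
closeAt k x (` y) with y ≟ x
... | yes _ = # k
... | no  _ = ` y
closeAt k x (# i) = # i
closeAt k x (a ⇒ b) = closeAt k x a ⇒ closeAt k x b
closeAt k x (● a) = ● closeAt k x a
closeAt k x (μ a) = μ closeAt (suc k) x a

μ[_]_ : ℕ → Ty → Ty
μ[ x ] a = μ (closeAt 0 x a)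

unfold : Ty → Ty → Ty
unfold a u = openAt 0 u a

-- capture-avoiding substitution A[B/X] (B locally closed)
subst : ℕ → Ty → Ty → Ty
subst x b (` y) with y ≟ x
... | yes _ = b
... | no  _ = ` y
subst x b (# i) = # i
subst x b (c ⇒ d) = subst x b c ⇒ subst x b d
subst x b (● c) = ● subst x b c
subst x b (μ c) = μ subst x b c

data _∈fv_ (x : ℕ) : Ty → Set where
  fv-var : x ∈fv (` x)
  fv-⇒ˡ : ∀ {a b} → x ∈fv a → x ∈fv (a ⇒ b)
  fv-⇒ʳ : ∀ {a b} → x ∈fv b → x ∈fv (a ⇒ b)
  fv-● : ∀ {a} → x ∈fv a → x ∈fv (● a)
  fv-μ : ∀ {a} → x ∈fv a → x ∈fv (μ a)

tail : Ty → Ty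
tail (` x) = ` x
tail (# i) = # i
tail (a ⇒ b) = tail b
tail (● a) = ● tail a
tail (μ a) = μ tail a

nth : List ℕ → ℕ → ℕ → Set
nth [] _ _ = ⊥
nth (n ∷ ns) zero m = n ≡ m
nth (n ∷ ns) (suc k) m = nth ns k m

-- TopChain ns T : T = •^{m_j} μ … μX_n.•^{m_n} X_i where the list ns
-- records, for every μ-binder already passed (innermost first), the
-- number of • occurring after it.  The final variable must be bound by
-- one of the binders of the chain (not shadowed: de Bruijn index) and
-- be preceded by at least one • after that binder.
data TopChain : List ℕ → Ty → Set where
  tc-var : ∀ {ns k m} → nth ns k (suc m) → TopChain ns (# k)
  tc-●   : ∀ {ns a} → TopChain (map suc ns) a → TopChain ns (● a)
  tc-μ   : ∀ {ns a} → TopChain (0 ∷ ns) a → TopChain ns (μ a)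

IsTopVariant : Ty → Set
IsTopVariant a = TopChain [] (tail a)

data Target : Set where
  free  : ℕ → Target
  bound : ℕ → Target

shiftT : Target → Target
shiftT (free x) = free x
shiftT (bound i) = bound (suc i)

Proper : Target → Ty → Set
Proper t (` y) = t ≢ free y
Proper t (# i) = t ≢ bound i
Proper t (a ⇒ b) = (Proper t a × Proper t b) ⊎ IsTopVariant b
Proper t (● a) = ⊤
Proper t (μ a) = Proper (shiftT t) a ⊎ IsTopVariant (μ a)

ProperIn : ℕ → Ty → Set
ProperIn x a = Proper (free x) a

WF : ℕ → Ty → Set
WF d (` x) = ⊤
WF d (# i) = i < d
WF d (a ⇒ b) = WF d a × WF d b
WF d (● a) = WF d a
WF d (μ a) = WF (suc d) a × Proper (bound 0) a

TypeExpr : Ty → Set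
TypeExpr = WF 0

data Mode : Set where
  ≅-mode ≃-mode : Mode

data Eqv : Mode → Ty → Ty → Set where
  e-refl  : ∀ {m a} → TypeExpr a → Eqv m a a
  e-sym   : ∀ {m a b} → Eqv m a b → Eqv m b a
  e-trans : ∀ {m a b c} → Eqv m a b → Eqv m b c → Eqv m a c
  e-●     : ∀ {m a b} → Eqv m a b → Eqv m (● a) (● b)
  e-⇒     : ∀ {m a b c d} → Eqv m a c → Eqv m b d → Eqv m (a ⇒ b) (c ⇒ d)
  e-⇒⊤    : ∀ {m a} → TypeExpr a → Eqv m (a ⇒ Top) Top
  e-unfold : ∀ {m a} → TypeExpr (μ a) → Eqv m (μ a) (unfold a (μ a))
  e-fold  : ∀ {m a c x} → TypeExpr c → ProperIn x c →
            Eqv m a (subst x a c) → Eqv m a (μ[ x ] c)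
  e-dist  : ∀ {a b} → TypeExpr a → TypeExpr b →
            Eqv ≃-mode (● (a ⇒ b)) (● a ⇒ ● b)

_≅_ : Ty → Ty → Set
_≅_ = Eqv ≅-mode

_≃_ : Ty → Ty → Set
_≃_ = Eqv ≃-mode

Assump : Set
Assump = List (ℕ × ℕ)

varsOf : Assump → List ℕ
varsOf = concatMap (λ p → proj₁ p ∷ proj₂ p ∷ [])

ValidAssump : Assump → Set
ValidAssump γ = Unique (varsOf γ)

IsUnion : Assump → Assump → Assump → Set
IsUnion γ₁ γ₂ γ = ∀ p → (p ∈ γ) ⇔ (p ∈ γ₁ ⊎ p ∈ γ₂)

FreeInAssump : ℕ → Assump → Set
FreeInAssump x γ = x ∈ varsOf γ

data Sub (m : Mode) : Assump → Ty → Ty → Set where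
  s-hyp   : ∀ {γ γ' x y} → ValidAssump γ → ValidAssump γ' →
            IsUnion γ [ (x , y) ] γ' → Sub m γ' (` x) (` y)
  s-top   : ∀ {γ a} → ValidAssump γ → TypeExpr a → Sub m γ a Top
  s-eqv   : ∀ {γ a b} → ValidAssump γ → Eqv m a b → Sub m γ a b
  s-trans : ∀ {γ₁ γ₂ γ a b c} → ValidAssump γ → IsUnion γ₁ γ₂ γ →
            Sub m γ₁ a b → Sub m γ₂ b c → Sub m γ a c
  s-●     : ∀ {γ a b} → Sub m γ a b → Sub m γ (● a) (● b)
  s-⇒     : ∀ {γ₁ γ₂ γ a a' b b'} → ValidAssump γ → IsUnion γ₁ γ₂ γ →
            Sub m γ₁ a' a → Sub m γ₂ b b' → Sub m γ (a ⇒ b) (a' ⇒ b')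
  s-μ     : ∀ {γ γ' x y a b} → ValidAssump γ → ValidAssump γ' →
            IsUnion γ [ (x , y) ] γ' →
            ¬ FreeInAssump x γ → ¬ (x ∈fv b) →
            ¬ FreeInAssump y γ → ¬ (y ∈fv a) →
            ProperIn x a → ProperIn y b →
            Sub m γ' a b → Sub m γ (μ[ x ] a) (μ[ y ] b)
  s-approx : ∀ {γ a} → ValidAssump γ → TypeExpr a → Sub m γ a (● a)

-- The invariant is the *end* of a type: follow its tail (arrow codomains,
-- bodies of • and μ) to the variable at the bottom, and record whether it is
-- bound by a μ of the tail (a cycle, as in ⊤ = μX.•X), a free variable X
-- below k bullets, or a dangling de Bruijn index below k bullets.
--  1. The end commutes with opening, closing and substitution.
--  2. Type expressions have no dangling end, ⊤-variants end in a cycle, and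
--     a body proper in X does not end in an unguarded X.
--  3. Equivalent types (≅ and ≃ alike) have the same end.
--  4. Subtyping preserves "⊤-likeness" of ends relative to any set of free
--     variables closed under γ; for the empty set: a supertype of ⊤ does
--     not end in a free variable.
--  5. Every type expression not ending in a free variable is ∼ ⊤ (induction
--     on the type, the fold rule in the μ case).
module Submission where

open import Defs
open import Data.Nat using (ℕ; zero; suc; _<_; _≤_; _+_; _⊔_; s≤s; z≤n)
open import Data.Nat.Properties
  using (_≟_; _<?_; suc-injective; ≤∧≢⇒<; m≤m⊔n; m≤n⊔m; <-irrefl; ≤-trans; ≤-refl; ≤-pred; n≤1+n; m≢1+n+m)
open import Data.List using ([]; _∷_; length; [_])
open import Data.List.Properties using (length-map)
open import Data.List.Membership.Propositional using (_∈_)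
open import Data.List.Membership.Propositional.Properties using (∈-concatMap⁺)
open import Data.List.Relation.Unary.Any using (here)
import Data.List.Relation.Unary.Any as Any
open import Data.Product using (_×_; _,_; proj₂)
open import Data.Sum using (_⊎_; inj₁; inj₂; map₂)
open import Data.Unit using (⊤; tt)
open import Data.Empty using (⊥; ⊥-elim)
open import Function using (_∘_)
open import Function.Bundles using (Equivalence)
open import Relation.Nullary using (¬_; yes; no)
open import Relation.Binary.PropositionalEquality
  using (_≡_; refl; sym; trans; cong; cong₂; _≢_) renaming (subst to ≡subst)

-- 1. Ends and their behaviour under opening, closing and substitution

data End : Set where
  loop : End               -- the tail runs into a cycle through one of its μ's
  var  : ℕ → ℕ → End       -- var x k: free variable x below k bullets
  idx  : ℕ → ℕ → End       -- idx i k: dangling index i below k bullets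

laterBy : ℕ → End → End
laterBy j loop = loop
laterBy j (var x k) = var x (j + k)
laterBy j (idx i k) = idx i (j + k)

later : End → End
later = laterBy 1

-- passing outwards through a μ: index 0 is captured and closes a cycle
exitμ : End → End
exitμ loop = loop
exitμ (var x k) = var x k
exitμ (idx zero k) = loop
exitμ (idx (suc i) k) = idx i k

end : Ty → End
end (` x) = var x 0
end (# i) = idx i 0
end (a ⇒ b) = end b
end (● a) = later (end a)
end (μ a) = exitμ (end a)

openE : ℕ → End → End → End
openE k u loop = loop
openE k u (var x j) = var x j
openE k u (idx i j) with i ≟ k
... | yes _ = laterBy j u
... | no _ = idx i j

closeE : ℕ → ℕ → End → End
closeE k x loop = loop
closeE k x (var y j) with y ≟ x
... | yes _ = idx k j
... | no _ = var y j
closeE k x (idx i j) = idx i j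

substE : ℕ → End → End → End
substE x u loop = loop
substE x u (var y j) with y ≟ x
... | yes _ = laterBy j u
... | no _ = var y j
substE x u (idx i j) = idx i j

Scoped : ℕ → End → Set
Scoped d (idx i _) = i < d
Scoped d _ = ⊤

Closed : End → Set
Closed = Scoped 0

laterBy-zero : ∀ u → laterBy 0 u ≡ u
laterBy-zero loop = refl
laterBy-zero (var x k) = refl
laterBy-zero (idx i k) = refl

later-laterBy : ∀ j u → later (laterBy j u) ≡ laterBy (suc j) u
later-laterBy j loop = refl
later-laterBy j (var x k) = refl
later-laterBy j (idx i k) = refl

exitμ-closed : ∀ j u → Closed u → exitμ (laterBy j u) ≡ laterBy j u
exitμ-closed j loop _ = refl
exitμ-closed j (var x k) _ = refl

-- Each syntactic operation commutes with taking ends, by induction on the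
-- type; the μ cases need the substituted end to be closed.
later-openE : ∀ k u r → later (openE k u r) ≡ openE k u (later r)
later-openE k u loop = refl
later-openE k u (var x j) = refl
later-openE k u (idx i j) with i ≟ k
... | yes _ = later-laterBy j u
... | no _ = refl

exitμ-openE : ∀ k u r → Closed u → exitμ (openE (suc k) u r) ≡ openE k u (exitμ r)
exitμ-openE k u loop _ = refl
exitμ-openE k u (var x j) _ = refl
exitμ-openE k u (idx zero j) _ = refl
exitμ-openE k u (idx (suc i) j) c with suc i ≟ suc k | i ≟ k
... | yes _ | yes _ = exitμ-closed j u c
... | yes p | no q = ⊥-elim (q (suc-injective p))
... | no p | yes q = ⊥-elim (p (cong suc q))
... | no _ | no _ = refl

end-openAt : ∀ k u a → Closed (end u) → end (openAt k u a) ≡ openE k (end u) (end a)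
end-openAt k u (` x) c = refl
end-openAt k u (# i) c with i ≟ k
... | yes _ = sym (laterBy-zero (end u))
... | no _ = refl
end-openAt k u (a ⇒ b) c = end-openAt k u b c
end-openAt k u (● a) c = trans (cong later (end-openAt k u a c)) (later-openE k (end u) (end a))
end-openAt k u (μ a) c = trans (cong exitμ (end-openAt (suc k) u a c)) (exitμ-openE k (end u) (end a) c)

later-closeE : ∀ k x r → later (closeE k x r) ≡ closeE k x (later r)
later-closeE k x loop = refl
later-closeE k x (var y j) with y ≟ x
... | yes _ = refl
... | no _ = refl
later-closeE k x (idx i j) = refl

exitμ-closeE : ∀ k x r → exitμ (closeE (suc k) x r) ≡ closeE k x (exitμ r)
exitμ-closeE k x loop = refl
exitμ-closeE k x (var y j) with y ≟ x
... | yes _ = refl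
... | no _ = refl
exitμ-closeE k x (idx zero j) = refl
exitμ-closeE k x (idx (suc i) j) = refl

end-closeAt : ∀ k x a → end (closeAt k x a) ≡ closeE k x (end a)
end-closeAt k x (` y) with y ≟ x
... | yes _ = refl
... | no _ = refl
end-closeAt k x (# i) = refl
end-closeAt k x (a ⇒ b) = end-closeAt k x b
end-closeAt k x (● a) = trans (cong later (end-closeAt k x a)) (later-closeE k x (end a))
end-closeAt k x (μ a) = trans (cong exitμ (end-closeAt (suc k) x a)) (exitμ-closeE k x (end a))

end-μ[] : ∀ x a → end (μ[ x ] a) ≡ exitμ (closeE 0 x (end a))
end-μ[] x a = cong exitμ (end-closeAt 0 x a)

later-substE : ∀ x u r → later (substE x u r) ≡ substE x u (later r)
later-substE x u loop = refl
later-substE x u (var y j) with y ≟ x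
... | yes _ = later-laterBy j u
... | no _ = refl
later-substE x u (idx i j) = refl

exitμ-substE : ∀ x u r → Closed u → exitμ (substE x u r) ≡ substE x u (exitμ r)
exitμ-substE x u loop c = refl
exitμ-substE x u (var y j) c with y ≟ x
... | yes _ = exitμ-closed j u c
... | no _ = refl
exitμ-substE x u (idx zero j) c = refl
exitμ-substE x u (idx (suc i) j) c = refl

end-subst : ∀ x u a → Closed (end u) → end (subst x u a) ≡ substE x (end u) (end a)
end-subst x u (` y) c with y ≟ x
... | yes _ = sym (laterBy-zero (end u))
... | no _ = refl
end-subst x u (# i) c = refl
end-subst x u (a ⇒ b) c = end-subst x u b c
end-subst x u (● a) c = trans (cong later (end-subst x u a c)) (later-substE x (end u) (end a))
end-subst x u (μ a) c = trans (cong exitμ (end-subst x u a c)) (exitμ-substE x (end u) (end a) c)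

-- 2. Ends of type expressions, ⊤-variants and proper bodies

later-scoped : ∀ d r → Scoped d r → Scoped d (later r)
later-scoped d loop s = tt
later-scoped d (var x k) s = tt
later-scoped d (idx i k) s = s

exitμ-scoped : ∀ d r → Scoped (suc d) r → Scoped d (exitμ r)
exitμ-scoped d loop s = tt
exitμ-scoped d (var x k) s = tt
exitμ-scoped d (idx zero k) s = tt
exitμ-scoped d (idx (suc i) k) s = ≤-pred s

end-scoped : ∀ d a → WF d a → Scoped d (end a)
end-scoped d (` x) w = tt
end-scoped d (# i) w = w
end-scoped d (a ⇒ b) (_ , wb) = end-scoped d b wb
end-scoped d (● a) w = later-scoped d (end a) (end-scoped d a w)
end-scoped d (μ a) (w , _) = exitμ-scoped d (end a) (end-scoped (suc d) a w)

end-closed : ∀ a → TypeExpr a → Closed (end a)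
end-closed = end-scoped 0

ChainEnd : ℕ → End → Set
ChainEnd n loop = ⊤
ChainEnd n (var _ _) = ⊥
ChainEnd n (idx i _) = i < n

nth-length : ∀ ns k {m} → nth ns k m → k < length ns
nth-length (n ∷ ns) zero p = s≤s z≤n
nth-length (n ∷ ns) (suc k) p = s≤s (nth-length ns k p)

chain-end : ∀ {ns t} → TopChain ns t → ChainEnd (length ns) (end t)
chain-end {ns} (tc-var {k = k} p) = nth-length ns k p
chain-end {ns} (tc-● {a = a} c) with end a | chain-end c
... | loop | _ = tt
... | idx i k | lt = ≡subst (i <_) (length-map suc ns) lt
chain-end {ns} (tc-μ {a = a} c) with end a | chain-end c
... | loop | _ = tt
... | idx zero k | _ = tt
... | idx (suc i) k | lt = ≤-pred lt

end-tail : ∀ b → end (tail b) ≡ end b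
end-tail (` x) = refl
end-tail (# i) = refl
end-tail (a ⇒ b) = end-tail b
end-tail (● a) = cong later (end-tail a)
end-tail (μ a) = cong exitμ (end-tail a)

topVariant-loop : ∀ b → IsTopVariant b → end b ≡ loop
topVariant-loop b tv with end (tail b) | chain-end tv | end-tail b
... | loop | _ | eq = sym eq

Guarded : ℕ → End → Set
Guarded x (var y zero) = y ≢ x
Guarded x _ = ⊤

exitμ-guarded : ∀ x r → Guarded x r → Guarded x (exitμ r)
exitμ-guarded x loop g = tt
exitμ-guarded x (var y zero) g = g
exitμ-guarded x (var y (suc k)) g = tt
exitμ-guarded x (idx zero k) g = tt
exitμ-guarded x (idx (suc i) k) g = tt

later-guarded : ∀ x r → Guarded x (later r)
later-guarded x loop = tt
later-guarded x (var y k) = tt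
later-guarded x (idx i k) = tt

loop-guarded : ∀ x r → r ≡ loop → Guarded x r
loop-guarded x .loop refl = tt

-- properness in X excludes an unguarded X at the end: ⊤-variant codomains
-- and μ-bodies end in a cycle, and • guards everything below it
proper-guarded : ∀ x c → ProperIn x c → Guarded x (end c)
proper-guarded x (` y) p = λ eq → p (cong free (sym eq))
proper-guarded x (# i) p = tt
proper-guarded x (a ⇒ b) (inj₁ (_ , pb)) = proper-guarded x b pb
proper-guarded x (a ⇒ b) (inj₂ tv) = loop-guarded x (end b) (topVariant-loop b tv)
proper-guarded x (● a) p = later-guarded x (end a)
proper-guarded x (μ a) (inj₁ p) = exitμ-guarded x (end a) (proper-guarded x a p)
proper-guarded x (μ a) (inj₂ tv) = loop-guarded x (end (μ a)) (topVariant-loop (μ a) tv)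

-- 3. Equivalent types have the same end

-- If U = C[U/X] on ends with C guarded in X, then U is the end of μX.C:
-- an unfolding through at least one bullet can only reproduce a cycle.
fold-end : ∀ x U r → Closed U → Closed r → Guarded x r →
           U ≡ substE x U r → U ≡ exitμ (closeE 0 x r)
fold-end x U loop _ _ _ eq = eq
fold-end x U (var y j) _ _ g eq with y ≟ x
fold-end x U (var y zero) _ _ g eq | yes y≡x = ⊥-elim (g y≡x)
fold-end x loop (var y (suc j)) _ _ _ eq | yes _ = refl
fold-end x (var z k) (var y (suc j)) _ _ _ eq | yes _ = ⊥-elim (m≢1+n+m k (cong counter eq))
  where
    counter : End → ℕ
    counter (var _ n) = n
    counter _ = 0
... | no _ = eq

unfold-end : ∀ r → Scoped 1 r → exitμ r ≡ openE 0 (exitμ r) r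
unfold-end loop _ = refl
unfold-end (var x k) _ = refl
unfold-end (idx zero j) _ = refl
unfold-end (idx (suc i) j) (s≤s ())

-- Every rule of ≅ and ≃ preserves the end; closedness of the end is
-- carried along because the unfold and fold cases need it.
eqv-end : ∀ {m a b} → Eqv m a b → Closed (end a) × end a ≡ end b
eqv-end (e-refl {a = a} t) = end-closed a t , refl
eqv-end (e-sym e) with eqv-end e
... | c , eq = ≡subst Closed eq c , sym eq
eqv-end (e-trans e f) with eqv-end e | eqv-end f
... | c , eq | _ , eq' = c , trans eq eq'
eqv-end (e-● {a = a} e) with eqv-end e
... | c , eq = later-scoped 0 (end a) c , cong later eq
eqv-end (e-⇒ e f) = eqv-end f
eqv-end (e-⇒⊤ t) = tt , refl
eqv-end (e-unfold {a = a} (w , _)) =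
  cμ , trans (unfold-end (end a) s) (sym (end-openAt 0 (μ a) a cμ))
  where
    s : Scoped 1 (end a)
    s = end-scoped 1 a w
    cμ : Closed (exitμ (end a))
    cμ = exitμ-scoped 0 (end a) s
eqv-end (e-fold {a = a} {c = c} {x = x} tc pr e) with eqv-end e
... | ca , eq =
  ca , trans (fold-end x (end a) (end c) ca (end-closed c tc) (proper-guarded x c pr)
               (trans eq (end-subst x a c ca)))
             (sym (end-μ[] x c))
eqv-end (e-dist {b = b} _ tb) = later-scoped 0 (end b) (end-closed b tb) , refl

-- 4. Soundness of subtyping for ⊤-likeness

-- An end is ⊤-like relative to a set ρ of free variables (regarded as ⊤)
-- unless it is a free variable outside ρ.
TopLike : (ℕ → Set) → End → Set
TopLike ρ (var x _) = ρ x
TopLike ρ _ = ⊤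

∅ : ℕ → Set
∅ _ = ⊥

extend : ℕ → (ℕ → Set) → ℕ → Set
extend x ρ z = z ≡ x ⊎ ρ z

Respects : (ℕ → Set) → Assump → Set
Respects ρ γ = ∀ {p q} → (p , q) ∈ γ → ρ p → ρ q

topLike-later⁺ : ∀ {ρ} r → TopLike ρ r → TopLike ρ (later r)
topLike-later⁺ loop h = h
topLike-later⁺ (var x k) h = h
topLike-later⁺ (idx i k) h = h

topLike-later⁻ : ∀ {ρ} r → TopLike ρ (later r) → TopLike ρ r
topLike-later⁻ loop h = h
topLike-later⁻ (var x k) h = h
topLike-later⁻ (idx i k) h = h

topLike-mono : ∀ {ρ ρ'} r → (∀ {z} → ρ z → ρ' z) → TopLike ρ r → TopLike ρ' r
topLike-mono loop f h = tt
topLike-mono (var x k) f h = f h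
topLike-mono (idx i k) f h = tt

topLike-exitμ : ∀ {ρ} r → TopLike ρ (exitμ r) → TopLike ρ r
topLike-exitμ loop h = tt
topLike-exitμ (var x k) h = h
topLike-exitμ (idx i k) h = tt

topLike-enter : ∀ ρ x r → TopLike ρ (exitμ (closeE 0 x r)) → TopLike (extend x ρ) r
topLike-enter ρ x loop h = tt
topLike-enter ρ x (var z k) h with z ≟ x
... | yes z≡x = inj₁ z≡x
... | no _ = inj₂ h
topLike-enter ρ x (idx i k) h = tt

topLike-exit : ∀ ρ x r → TopLike (extend x ρ) r → TopLike ρ (exitμ (closeE 0 x r))
topLike-exit ρ x loop h = tt
topLike-exit ρ x (var z k) h with z ≟ x | h
... | yes _ | _ = tt
... | no z≢x | inj₁ z≡x = ⊥-elim (z≢x z≡x)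
... | no _ | inj₂ ρz = ρz
topLike-exit ρ x (idx zero k) h = tt
topLike-exit ρ x (idx (suc i) k) h = tt

Avoids : ℕ → End → Set
Avoids x (var z _) = z ≢ x
Avoids x _ = ⊤

end-avoids : ∀ x a → ¬ (x ∈fv a) → Avoids x (end a)
end-avoids x (` y) nf = λ { refl → nf fv-var }
end-avoids x (# i) nf = tt
end-avoids x (a ⇒ b) nf = end-avoids x b (nf ∘ fv-⇒ʳ)
end-avoids x (● a) nf with end a | end-avoids x a (nf ∘ fv-●)
... | loop | _ = tt
... | var y k | av = av
... | idx i k | _ = tt
end-avoids x (μ a) nf with end a | end-avoids x a (nf ∘ fv-μ)
... | loop | _ = tt
... | var y k | av = av
... | idx zero k | _ = tt
... | idx (suc i) k | _ = tt

topLike-drop : ∀ ρ x r → Avoids x r → TopLike (extend x ρ) r → TopLike ρ r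
topLike-drop ρ x loop av h = tt
topLike-drop ρ x (var z k) av (inj₁ z≡x) = ⊥-elim (av z≡x)
topLike-drop ρ x (var z k) av (inj₂ ρz) = ρz
topLike-drop ρ x (idx i k) av h = tt

respects-μ : ∀ {ρ γ γ' x y} → IsUnion γ [ (x , y) ] γ' →
             ¬ FreeInAssump x γ → ¬ FreeInAssump y γ →
             Respects ρ γ → Respects (extend x (extend y ρ)) γ'
respects-μ {ρ} {γ} {x = x} {y} u x∉γ y∉γ resp {p} {q} mem hp
  with Equivalence.to (u (p , q)) mem
... | inj₂ (here refl) = inj₂ (inj₁ refl)
... | inj₁ pq∈γ = inj₂ (inj₂ (resp pq∈γ (unextend hp)))
  where
    p∈γ : p ∈ varsOf γ
    p∈γ = ∈-concatMap⁺ _ (Any.map (λ { refl → here refl }) pq∈γ)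
    unextend : extend x (extend y ρ) p → ρ p
    unextend (inj₁ refl) = ⊥-elim (x∉γ p∈γ)
    unextend (inj₂ (inj₁ refl)) = ⊥-elim (y∉γ p∈γ)
    unextend (inj₂ (inj₂ ρp)) = ρp

sub-end : ∀ {m γ a b} → Sub m γ a b → ∀ ρ → Respects ρ γ → TopLike ρ (end a) → TopLike ρ (end b)
sub-end (s-hyp {x = x} {y = y} _ _ u) ρ resp h = resp (Equivalence.from (u (x , y)) (inj₂ (here refl))) h
sub-end (s-top _ _) ρ resp h = tt
sub-end (s-eqv _ e) ρ resp h = ≡subst (TopLike ρ) (proj₂ (eqv-end e)) h
sub-end (s-trans _ u s₁ s₂) ρ resp h =
  sub-end s₂ ρ (resp ∘ Equivalence.from (u _) ∘ inj₂) (sub-end s₁ ρ (resp ∘ Equivalence.from (u _) ∘ inj₁) h)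
sub-end (s-● {a = a} {b = b} s) ρ resp h =
  topLike-later⁺ (end b) (sub-end s ρ resp (topLike-later⁻ (end a) h))
sub-end (s-⇒ _ u _ s₂) ρ resp h = sub-end s₂ ρ (resp ∘ Equivalence.from (u _) ∘ inj₂) h
-- μ-rule: enter μX.a with X regarded as ⊤, carry this to b through the
-- premise (with X and Y regarded as ⊤), forget X (not free in b), exit μY.b.
sub-end (s-μ {x = x} {y = y} {a = a} {b = b} _ _ u x∉γ x∉b y∉γ _ _ _ s) ρ resp h =
  ≡subst (TopLike ρ) (sym (end-μ[] y b))
    (topLike-exit ρ y (end b)
      (topLike-drop (extend y ρ) x (end b) (end-avoids x b x∉b)
        (sub-end s (extend x (extend y ρ)) (respects-μ u x∉γ y∉γ resp)
          (topLike-mono (end a) (map₂ inj₂)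
            (topLike-enter ρ x (end a) (≡subst (TopLike ρ) (end-μ[] x a) h))))))
sub-end (s-approx {a = a} _ _) ρ resp h = topLike-later⁺ (end a) h

-- 5. Types not ending in a free variable are equivalent to ⊤

Top-wf : ∀ k → WF k Top
Top-wf k = s≤s z≤n , tt

plugTop : ℕ → Ty → Ty
plugTop k (` x) = ` x
plugTop k (# i) with i <? k
... | yes _ = # i
... | no _ = Top
plugTop k (a ⇒ b) = plugTop k a ⇒ plugTop k b
plugTop k (● a) = ● plugTop k a
plugTop k (μ a) = μ plugTop (suc k) a

plugTop-id : ∀ k a → WF k a → plugTop k a ≡ a
plugTop-id k (` x) w = refl
plugTop-id k (# i) w with i <? k
... | yes _ = refl
... | no i≮k = ⊥-elim (i≮k w)
plugTop-id k (a ⇒ b) (wa , wb) = cong₂ _⇒_ (plugTop-id k a wa) (plugTop-id k b wb)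
plugTop-id k (● a) w = cong ●_ (plugTop-id k a w)
plugTop-id k (μ a) (w , _) = cong μ_ (plugTop-id (suc k) a w)

-- Replacing dangling indices preserves ⊤-variants: their tail is closed.
tail-plugTop : ∀ k b → tail (plugTop k b) ≡ plugTop k (tail b)
tail-plugTop k (` x) = refl
tail-plugTop k (# i) with i <? k
... | yes _ = refl
... | no _ = refl
tail-plugTop k (a ⇒ b) = tail-plugTop k b
tail-plugTop k (● a) = cong ●_ (tail-plugTop k a)
tail-plugTop k (μ a) = cong μ_ (tail-plugTop (suc k) a)

chain-plugTop : ∀ {ns t} → TopChain ns t → ∀ k → length ns ≤ k → plugTop k t ≡ t
chain-plugTop {ns} (tc-var {k = i} p) k le with i <? k
... | yes _ = refl
... | no i≮k = ⊥-elim (i≮k (≤-trans (nth-length ns i p) le))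
chain-plugTop {ns} (tc-● c) k le = cong ●_ (chain-plugTop c k (≡subst (_≤ k) (sym (length-map suc ns)) le))
chain-plugTop (tc-μ c) k le = cong μ_ (chain-plugTop c (suc k) (s≤s le))

topVariant-plugTop : ∀ k b → IsTopVariant b → IsTopVariant (plugTop k b)
topVariant-plugTop k b tv =
  ≡subst (TopChain []) (sym (trans (tail-plugTop k b) (chain-plugTop tv k z≤n))) tv

tail-openAt : ∀ k x b → tail (openAt k (` x) b) ≡ openAt k (` x) (tail b)
tail-openAt k x (` y) = refl
tail-openAt k x (# i) with i ≟ k
... | yes _ = refl
... | no _ = refl
tail-openAt k x (a ⇒ b) = tail-openAt k x b
tail-openAt k x (● a) = cong ●_ (tail-openAt k x a)
tail-openAt k x (μ a) = cong μ_ (tail-openAt (suc k) x a)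

chain-openAt : ∀ {ns t} → TopChain ns t → ∀ k u → length ns ≤ k → openAt k u t ≡ t
chain-openAt {ns} (tc-var {k = i} p) k u le with i ≟ k
... | yes refl = ⊥-elim (<-irrefl refl (≤-trans (nth-length ns i p) le))
... | no _ = refl
chain-openAt {ns} (tc-● c) k u le =
  cong ●_ (chain-openAt c k u (≡subst (_≤ k) (sym (length-map suc ns)) le))
chain-openAt (tc-μ c) k u le = cong μ_ (chain-openAt c (suc k) u (s≤s le))

topVariant-openAt : ∀ k x b → IsTopVariant b → IsTopVariant (openAt k (` x) b)
topVariant-openAt k x b tv =
  ≡subst (TopChain []) (sym (trans (tail-openAt k x b) (chain-openAt tv k (` x) z≤n))) tv

-- Well-formedness of plugTop: ⊤ is proper in everything.
proper-plugTop : ∀ j k a → Proper (bound j) a → j < k → Proper (bound j) (plugTop k a)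
proper-plugTop j k (` x) p lt = p
proper-plugTop j k (# i) p lt with i <? k
... | yes _ = p
... | no _ = inj₁ tt
proper-plugTop j k (a ⇒ b) (inj₁ (pa , pb)) lt = inj₁ (proper-plugTop j k a pa lt , proper-plugTop j k b pb lt)
proper-plugTop j k (a ⇒ b) (inj₂ tv) lt = inj₂ (topVariant-plugTop k b tv)
proper-plugTop j k (● a) p lt = tt
proper-plugTop j k (μ a) (inj₁ p) lt = inj₁ (proper-plugTop (suc j) (suc k) a p (s≤s lt))
proper-plugTop j k (μ a) (inj₂ tv) lt = inj₂ (topVariant-plugTop k (μ a) tv)

wf-plugTop : ∀ d k a → WF d a → WF k (plugTop k a)
wf-plugTop d k (` x) w = tt
wf-plugTop d k (# i) w with i <? k
... | yes i<k = i<k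
... | no _ = Top-wf k
wf-plugTop d k (a ⇒ b) (wa , wb) = wf-plugTop d k a wa , wf-plugTop d k b wb
wf-plugTop d k (● a) w = wf-plugTop d k a w
wf-plugTop d k (μ a) (w , pr) = wf-plugTop (suc d) (suc k) a w , proper-plugTop 0 (suc k) a pr (s≤s z≤n)

-- ⊤ is closed, so opening after plugging at depth k+1 is plugging at depth k
openAt-plugTop : ∀ k a → openAt k Top (plugTop (suc k) a) ≡ plugTop k a
openAt-plugTop k (` x) = refl
openAt-plugTop k (# i) with i <? suc k | i <? k
... | yes _ | yes i<k = open-below i<k
  where
    open-below : i < k → openAt k Top (# i) ≡ # i
    open-below lt with i ≟ k
    ... | yes refl = ⊥-elim (<-irrefl refl lt)
    ... | no _ = refl
... | yes i<1+k | no i≮k = open-at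
  where
    open-at : openAt k Top (# i) ≡ Top
    open-at with i ≟ k
    ... | yes _ = refl
    ... | no i≢k = ⊥-elim (i≮k (≤∧≢⇒< (≤-pred i<1+k) i≢k))
... | no i≮1+k | yes i<k = ⊥-elim (i≮1+k (≤-trans i<k (n≤1+n k)))
... | no _ | no _ = refl
openAt-plugTop k (a ⇒ b) = cong₂ _⇒_ (openAt-plugTop k a) (openAt-plugTop k b)
openAt-plugTop k (● a) = cong ●_ (openAt-plugTop k a)
openAt-plugTop k (μ a) = cong μ_ (openAt-plugTop (suc k) a)

proper-openAt-other : ∀ j k x a → Proper (bound j) a → j ≢ k → Proper (bound j) (openAt k (` x) a)
proper-openAt-other j k x (` y) p ne = p
proper-openAt-other j k x (# i) p ne with i ≟ k
... | yes _ = λ ()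
... | no _ = p
proper-openAt-other j k x (a ⇒ b) (inj₁ (pa , pb)) ne =
  inj₁ (proper-openAt-other j k x a pa ne , proper-openAt-other j k x b pb ne)
proper-openAt-other j k x (a ⇒ b) (inj₂ tv) ne = inj₂ (topVariant-openAt k x b tv)
proper-openAt-other j k x (● a) p ne = tt
proper-openAt-other j k x (μ a) (inj₁ p) ne =
  inj₁ (proper-openAt-other (suc j) (suc k) x a p (ne ∘ suc-injective))
proper-openAt-other j k x (μ a) (inj₂ tv) ne = inj₂ (topVariant-openAt k x (μ a) tv)

wf-openAt : ∀ k x t → WF (suc k) t → WF k (openAt k (` x) t)
wf-openAt k x (` y) w = tt
wf-openAt k x (# i) w with i ≟ k
... | yes _ = tt
... | no i≢k = ≤∧≢⇒< (≤-pred w) i≢k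
wf-openAt k x (a ⇒ b) (wa , wb) = wf-openAt k x a wa , wf-openAt k x b wb
wf-openAt k x (● a) w = wf-openAt k x a w
wf-openAt k x (μ a) (w , pr) = wf-openAt (suc k) x a w , proper-openAt-other 0 (suc k) x a pr (λ ())

proper-openAt-fresh : ∀ k x a → Proper (bound k) a → ¬ (x ∈fv a) → ProperIn x (openAt k (` x) a)
proper-openAt-fresh k x (` y) p nf = λ { refl → nf fv-var }
proper-openAt-fresh k x (# i) p nf with i ≟ k
... | yes refl = ⊥-elim (p refl)
... | no _ = λ ()
proper-openAt-fresh k x (a ⇒ b) (inj₁ (pa , pb)) nf =
  inj₁ (proper-openAt-fresh k x a pa (nf ∘ fv-⇒ˡ) , proper-openAt-fresh k x b pb (nf ∘ fv-⇒ʳ))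
proper-openAt-fresh k x (a ⇒ b) (inj₂ tv) nf = inj₂ (topVariant-openAt k x b tv)
proper-openAt-fresh k x (● a) p nf = tt
proper-openAt-fresh k x (μ a) (inj₁ p) nf = inj₁ (proper-openAt-fresh (suc k) x a p (nf ∘ fv-μ))
proper-openAt-fresh k x (μ a) (inj₂ tv) nf = inj₂ (topVariant-openAt k x (μ a) tv)

closeAt-openAt : ∀ k x t → ¬ (x ∈fv t) → closeAt k x (openAt k (` x) t) ≡ t
closeAt-openAt k x (` y) nf with y ≟ x
... | yes refl = ⊥-elim (nf fv-var)
... | no _ = refl
closeAt-openAt k x (# i) nf with i ≟ k
closeAt-openAt k x (# i) nf | yes refl with x ≟ x
... | yes _ = refl
... | no x≢x = ⊥-elim (x≢x refl)
closeAt-openAt k x (# i) nf | no _ = refl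
closeAt-openAt k x (a ⇒ b) nf = cong₂ _⇒_ (closeAt-openAt k x a (nf ∘ fv-⇒ˡ)) (closeAt-openAt k x b (nf ∘ fv-⇒ʳ))
closeAt-openAt k x (● a) nf = cong ●_ (closeAt-openAt k x a (nf ∘ fv-●))
closeAt-openAt k x (μ a) nf = cong μ_ (closeAt-openAt (suc k) x a (nf ∘ fv-μ))

subst-openAt : ∀ k x u t → ¬ (x ∈fv t) → subst x u (openAt k (` x) t) ≡ openAt k u t
subst-openAt k x u (` y) nf with y ≟ x
... | yes refl = ⊥-elim (nf fv-var)
... | no _ = refl
subst-openAt k x u (# i) nf with i ≟ k
subst-openAt k x u (# i) nf | yes refl with x ≟ x
... | yes _ = refl
... | no x≢x = ⊥-elim (x≢x refl)
subst-openAt k x u (# i) nf | no _ = refl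
subst-openAt k x u (a ⇒ b) nf = cong₂ _⇒_ (subst-openAt k x u a (nf ∘ fv-⇒ˡ)) (subst-openAt k x u b (nf ∘ fv-⇒ʳ))
subst-openAt k x u (● a) nf = cong ●_ (subst-openAt k x u a (nf ∘ fv-●))
subst-openAt k x u (μ a) nf = cong μ_ (subst-openAt (suc k) x u a (nf ∘ fv-μ))

maxFree : Ty → ℕ
maxFree (` x) = x
maxFree (# i) = 0
maxFree (a ⇒ b) = maxFree a ⊔ maxFree b
maxFree (● a) = maxFree a
maxFree (μ a) = maxFree a

free≤maxFree : ∀ {x} a → x ∈fv a → x ≤ maxFree a
free≤maxFree (` x) fv-var = ≤-refl
free≤maxFree (a ⇒ b) (fv-⇒ˡ p) = ≤-trans (free≤maxFree a p) (m≤m⊔n (maxFree a) (maxFree b))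
free≤maxFree (a ⇒ b) (fv-⇒ʳ p) = ≤-trans (free≤maxFree b p) (m≤n⊔m (maxFree a) (maxFree b))
free≤maxFree (● a) (fv-● p) = free≤maxFree a p
free≤maxFree (μ a) (fv-μ p) = free≤maxFree a p

fresh-∉ : ∀ a → ¬ (suc (maxFree a) ∈fv a)
fresh-∉ a p = <-irrefl refl (free≤maxFree a p)

fold : ∀ {m u} t → WF 1 t → Proper (bound 0) t → Eqv m u (openAt 0 u t) → Eqv m u (μ t)
fold {m} {u} t w pr e =
  ≡subst (λ s → Eqv m u (μ s)) (closeAt-openAt 0 x t x∉t)
    (e-fold (wf-openAt 0 x t w) (proper-openAt-fresh 0 x t pr x∉t)
      (≡subst (Eqv m u) (sym (subst-openAt 0 x u t x∉t)) e))
  where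
    x : ℕ
    x = suc (maxFree t)
    x∉t : ¬ (x ∈fv t)
    x∉t = fresh-∉ t

-- ⊤ is its own unfolding •⊤
Top-later : ∀ {m} → Eqv m (● Top) Top
Top-later = e-sym (e-unfold (Top-wf 0))

plugTop-topLike : ∀ {m} d a → WF d a → TopLike ∅ (end a) → Eqv m (plugTop 0 a) Top
plugTop-topLike d (` x) w ()
plugTop-topLike d (# i) w _ with i <? 0
... | no _ = e-refl (Top-wf 0)
plugTop-topLike d (a ⇒ b) (wa , wb) h =
  e-trans (e-⇒ (e-refl a') (plugTop-topLike d b wb h)) (e-⇒⊤ a')
  where
    a' : TypeExpr (plugTop 0 a)
    a' = wf-plugTop d 0 a wa
plugTop-topLike d (● a) w h =
  e-trans (e-● (plugTop-topLike d a w (topLike-later⁻ (end a) h))) Top-later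
plugTop-topLike {m} d (μ a) (w , pr) h =
  e-sym (fold body (wf-plugTop (suc d) 1 a w) (proper-plugTop 0 1 a pr (s≤s z≤n)) Top∼unfolded)
  where
    body : Ty
    body = plugTop 1 a
    Top∼unfolded : Eqv m Top (openAt 0 Top body)
    Top∼unfolded = ≡subst (Eqv m Top) (sym (openAt-plugTop 0 a))
                  (e-sym (plugTop-topLike (suc d) a w (topLike-exitμ (end a) h)))

topLike⇒Top : ∀ {m} a → TypeExpr a → TopLike ∅ (end a) → Eqv m a Top
topLike⇒Top a te h = ≡subst (λ t → Eqv _ t Top) (plugTop-id 0 a te) (plugTop-topLike 0 a te h)

-- The theorem: ⊤'s end is a cycle, so A's end is not a free variable.
proposition5p6 : (m : Mode) (γ : Assump) (A : Ty) → ValidAssump γ → TypeExpr A →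
                   Sub m γ Top A → Eqv m A Top
proposition5p6 _ _ A _ te s = topLike⇒Top A te (sub-end s ∅ (λ _ ()) tt)
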